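{- Let $L$ be a finite distributive lattice and $\phi$ any coloring of the points of $L$. If every automorphism of $Q_L$ that preserves the restriction of $\phi$ to $Q_L$ fixes every point of $Q_L$ (i.e., $\phi|_{Q_L}$ pins every point of $Q_L$), then every automorphism of $L$ preserving $\phi$ fixes every point of $L$ (i.e., $\phi$ pins every point of $L$).
   Context: A point $x$ of a lattice is join-irreducible if in the Hasse diagram it has exactly one downward edge (it covers exactly one element). $Q_L$ denotes the subposet of $L$ induced by its join-irreducible points. Given a coloring of a poset $P$, a point $x$ is pinned if every color-preserving automorphism of $P$ maps $x$ to itself. -}

module Defs where

open import Data.Nat using (ℕ)
open import Data.Fin using (Fin)
open import Data.Product using (Σ; ∃; _×_; _,_)
open import Relation.Binary.PropositionalEquality using (_≡_)
open import Relation.Binary.Core using (Rel)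
open import Relation.Nullary using (¬_)
open import Function.Bundles using (_⇔_)
open import Algebra.Core using (Op₂)
open import Relation.Binary.Lattice.Structures using (IsDistributiveLattice)

record FinDistLattice : Set₁ where
  field
    n     : ℕ
    _≤_   : Rel (Fin n) _
    _∨_   : Op₂ (Fin n)
    _∧_   : Op₂ (Fin n)
    isDistributiveLattice : IsDistributiveLattice {A = Fin n} _≡_ _≤_ _∨_ _∧_

module _ (L : FinDistLattice) where
  open FinDistLattice L

  _<_ : Fin n → Fin n → Set
  x < y = (x ≤ y) × ¬ (x ≡ y)

  Covers : Fin n → Fin n → Set
  Covers x y = (y < x) × (∀ z → y < z → ¬ (z < x))

  JoinIrr : Fin n → Set
  JoinIrr x = Σ (Fin n) (λ y → Covers x y × (∀ y′ → Covers x y′ → y′ ≡ y))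

  -- automorphism of L as a poset (equivalently as a lattice): a bijection of
  -- the carrier (with two-sided inverse) that preserves and reflects ≤
  record Aut : Set where
    field
      f : Fin n → Fin n
      g : Fin n → Fin n
      fg : ∀ x → f (g x) ≡ x
      gf : ∀ x → g (f x) ≡ x
      mono : ∀ x y → (x ≤ y) ⇔ (f x ≤ f y)

  -- automorphism of the induced subposet Q_L on join-irreducible points;
  -- points of Q_L are pairs (x , proof that x is join-irreducible), compared by x
  record AutQ : Set where
    field
      f : (x : Fin n) → JoinIrr x → Fin n
      f-JI : ∀ x p → JoinIrr (f x p)
      g : (x : Fin n) → JoinIrr x → Fin n
      g-JI : ∀ x p → JoinIrr (g x p)
      fg : ∀ x p → f (g x p) (g-JI x p) ≡ x
      gf : ∀ x p → g (f x p) (f-JI x p) ≡ x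
      mono : ∀ x p y q → (x ≤ y) ⇔ (f x p ≤ f y q)

  PinsAll : {C : Set} → (Fin n → C) → Set
  PinsAll φ = (σ : Aut) → (∀ x → φ (Aut.f σ x) ≡ φ x) → ∀ x → Aut.f σ x ≡ x

  PinsAllQ : {C : Set} → (Fin n → C) → Set
  PinsAllQ φ = (σ : AutQ) → (∀ x p → φ (AutQ.f σ x p) ≡ φ x) → ∀ x p → AutQ.f σ x p ≡ x

module Submission where

-- Every element x of a finite lattice has one of three shapes
-- (`Shape`): it is the least element, it is join-irreducible, or it is the
-- join a ∨ b of two elements strictly below it (a lower cover a of x joined
-- with any b < x not below a gives x).  An automorphism σ of L maps join-irreducibles
-- to join-irreducibles, so it restricts to an automorphism of Q_L preserving
-- the colours; by hypothesis this restriction is the identity.  Then σ fixes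
-- every x by well-founded induction on the strict order: the least element is
-- fixed by any automorphism, join-irreducibles are fixed by hypothesis, and a
-- join of fixed points is fixed.

open import Defs renaming (_<_ to strictOrder)
open import Data.Fin using (Fin)
open import Data.Fin.Properties using (_≟_; any?)
open import Data.Fin.Induction using (po-wellFounded; po-noetherian)
open import Data.Product using (Σ; _×_; _,_; proj₁)
open import Data.Empty using (⊥-elim)
open import Function using (flip)
open import Function.Bundles using (Equivalence; mk⇔)
open import Induction.WellFounded using (Acc; acc)
open import Relation.Nullary using (¬_; Dec; yes; no; ¬?)
open import Relation.Nullary.Decidable using (_×-dec_)
open import Relation.Binary.PropositionalEquality
  using (_≡_; sym; trans; cong; subst; subst₂)
open import Relation.Binary.Lattice.Structures using (IsDistributiveLattice; IsLattice)

module FiniteLattice (L : FinDistLattice) where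
  open FinDistLattice L
  open IsDistributiveLattice isDistributiveLattice using (isLattice)
  open IsLattice isLattice public
    using (isPartialOrder; x≤x∨y; y≤x∨y; ∨-least; x∧y≤x; x∧y≤y)
    renaming (refl to ≤-refl; trans to ≤-trans; antisym to ≤-antisym)

  _<_ : Fin n → Fin n → Set
  _<_ = strictOrder L

  -- The order is decidable, since x ≤ y holds exactly when x ∨ y ≡ y.
  _≤?_ : ∀ x y → Dec (x ≤ y)
  x ≤? y with (x ∨ y) ≟ y
  ... | yes x∨y≡y = yes (subst (x ≤_) x∨y≡y (x≤x∨y x y))
  ... | no  x∨y≢y = no λ x≤y → x∨y≢y (≤-antisym (∨-least x≤y ≤-refl) (y≤x∨y x y))

  _<?_ : ∀ x y → Dec (x < y)
  x <? y = (x ≤? y) ×-dec ¬? (x ≟ y)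

  -- An element with nothing strictly below it is the least element:
  -- otherwise x ∧ y would lie strictly below x.
  minimal⇒least : ∀ x → (∀ z → ¬ z < x) → ∀ y → x ≤ y
  minimal⇒least x minimal y with (x ∧ y) ≟ x
  ... | yes x∧y≡x = subst (_≤ y) x∧y≡x (x∧y≤y x y)
  ... | no  x∧y≢x = ⊥-elim (minimal (x ∧ y) (x∧y≤x x y , x∧y≢x))

  -- Climb from z
  -- towards x as long as there is an element strictly in between; the
  -- climb terminates because the reversed strict order is well-founded.
  below-lowerCover : ∀ x z → z < x → Σ (Fin n) λ c → Covers L x c × z ≤ c
  below-lowerCover x z = climb z (po-noetherian isPartialOrder z)
    where
      climb : ∀ z → Acc (flip _<_) z → z < x → Σ (Fin n) λ c → Covers L x c × z ≤ c
      climb z (acc above) z<x with any? (λ w → (z <? w) ×-dec (w <? x))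
      ... | yes (w , z<w , w<x) =
        let c , x⋗c , w≤c = climb w (above z<w) w<x
        in  c , x⋗c , ≤-trans (proj₁ z<w) w≤c
      ... | no nothingBetween = z , (z<x , λ w z<w w<x → nothingBetween (w , z<w , w<x)) , ≤-refl

  -- If a is a lower cover of x and b < x is not below a, then a ∨ b ≡ x:
  -- a ∨ b lies strictly above a and below x, so it cannot differ from x.
  join-with-lowerCover : ∀ x a b → Covers L x a → b < x → ¬ b ≤ a → (a ∨ b) ≡ x
  join-with-lowerCover x a b (a<x , nothingBetween) (b≤x , _) b≰a with (a ∨ b) ≟ x
  ... | yes a∨b≡x = a∨b≡x
  ... | no  a∨b≢x = ⊥-elim (nothingBetween (a ∨ b) a<a∨b (∨-least (proj₁ a<x) b≤x , a∨b≢x))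
    where
      a<a∨b : a < (a ∨ b)
      a<a∨b = x≤x∨y a b , λ a≡a∨b → b≰a (subst (b ≤_) (sym a≡a∨b) (y≤x∨y a b))

  unique-lowerCover : ∀ x a → Covers L x a → (∀ b → b < x → b ≤ a) → JoinIrr L x
  unique-lowerCover x a x⋗a allBelow = a , x⋗a , unique
    where
      unique : ∀ b → Covers L x b → b ≡ a
      unique b (b<x , nothingBetween) with b ≟ a
      ... | yes b≡a = b≡a
      ... | no  b≢a = ⊥-elim (nothingBetween a (allBelow b b<x , b≢a) (proj₁ x⋗a))

  data Shape (x : Fin n) : Set where
    least   : (∀ y → x ≤ y) → Shape x
    joinIrr : JoinIrr L x → Shape x
    join    : ∀ a b → a < x → b < x → (a ∨ b) ≡ x → Shape x

  shape : ∀ x → Shape x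
  shape x with any? (λ z → z <? x)
  ... | no nothingBelow = least (minimal⇒least x λ z z<x → nothingBelow (z , z<x))
  ... | yes (z , z<x) with below-lowerCover x z z<x
  ...   | a , x⋗a , _ with any? (λ b → (b <? x) ×-dec ¬? (b ≤? a))
  ...     | yes (b , b<x , b≰a) = join a b (proj₁ x⋗a) b<x (join-with-lowerCover x a b x⋗a b<x b≰a)
  ...     | no noOther = joinIrr (unique-lowerCover x a x⋗a allBelow)
    where
      allBelow : ∀ b → b < x → b ≤ a
      allBelow b b<x with b ≤? a
      ... | yes b≤a = b≤a
      ... | no  b≰a = ⊥-elim (noOther (b , b<x , b≰a))

module Automorphism (L : FinDistLattice) where
  open FinDistLattice L
  open FiniteLattice L

  inverse : Aut L → Aut L
  inverse σ = record
    { f = g ; g = f ; fg = gf ; gf = fg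
    ; mono = λ x y → mk⇔ (λ x≤y → from (subst₂ _≤_ (sym (fg x)) (sym (fg y)) x≤y))
                         (λ gx≤gy → subst₂ _≤_ (fg x) (fg y) (to gx≤gy))
    }
    where
      open Aut σ
      to : ∀ {x y} → x ≤ y → f x ≤ f y
      to = Equivalence.to (mono _ _)
      from : ∀ {x y} → f x ≤ f y → x ≤ y
      from = Equivalence.from (mono _ _)

  module _ (σ : Aut L) where
    open Aut σ

    monotone : ∀ {x y} → x ≤ y → f x ≤ f y
    monotone = Equivalence.to (mono _ _)

    <-preserve : ∀ {x y} → x < y → f x < f y
    <-preserve (x≤y , x≢y) = monotone x≤y , λ fx≡fy → x≢y (trans (sym (gf _)) (trans (cong g fx≡fy) (gf _)))

    <-reflect : ∀ {x y} → f x < f y → x < y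
    <-reflect (fx≤fy , fx≢fy) = Equivalence.from (mono _ _) fx≤fy , λ x≡y → fx≢fy (cong f x≡y)

    covers-preserve : ∀ {x y} → Covers L x y → Covers L (f x) (f y)
    covers-preserve (y<x , nothingBetween) = <-preserve y<x , λ z fy<z z<fx →
      nothingBetween (g z) (<-reflect (subst (f _ <_) (sym (fg z)) fy<z))
                           (<-reflect (subst (_< f _) (sym (fg z)) z<fx))

    inverse-fixes : ∀ {x} → f x ≡ x → g x ≡ x
    inverse-fixes {x} fx≡x = trans (cong g (sym fx≡x)) (gf x)

    -- If x lies below its images under σ and under σ⁻¹, it is fixed:
    -- applying σ to x ≤ σ⁻¹ x gives σ x ≤ x.
    fixed-if-below-images : ∀ x → x ≤ f x → x ≤ g x → f x ≡ x
    fixed-if-below-images x x≤fx x≤gx = ≤-antisym (subst (f x ≤_) (fg x) (monotone x≤gx)) x≤fx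

  -- Automorphisms map join-irreducibles to join-irreducibles: the unique
  -- lower cover of x is carried to the unique lower cover of σ x, since
  -- covers are both preserved by σ and (via σ⁻¹) reflected.
  joinIrr-preserve : (σ : Aut L) → ∀ x → JoinIrr L x → JoinIrr L (Aut.f σ x)
  joinIrr-preserve σ x (a , x⋗a , unique) = f a , covers-preserve σ x⋗a , uniqueImage
    where
      open Aut σ
      uniqueImage : ∀ b → Covers L (f x) b → b ≡ f a
      uniqueImage b fx⋗b =
        trans (sym (fg b)) (cong f (unique (g b) (subst (λ y → Covers L y (g b)) (gf x)
                                                        (covers-preserve (inverse σ) fx⋗b))))

  restrict : Aut L → AutQ L
  restrict σ = record
    { f = λ x _ → f x ; f-JI = joinIrr-preserve σ
    ; g = λ x _ → g x ; g-JI = joinIrr-preserve (inverse σ)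
    ; fg = λ x _ → fg x ; gf = λ x _ → gf x
    ; mono = λ x _ y _ → mono x y
    }
    where open Aut σ

  -- The join of two fixed points is fixed: it lies below its images under
  -- σ and σ⁻¹ because both are monotone and fix a and b.
  join-fixed : (σ : Aut L) → ∀ a b → Aut.f σ a ≡ a → Aut.f σ b ≡ b → Aut.f σ (a ∨ b) ≡ (a ∨ b)
  join-fixed σ a b fa≡a fb≡b =
    fixed-if-below-images σ (a ∨ b) (below-image σ fa≡a fb≡b)
                                    (below-image (inverse σ) (inverse-fixes σ fa≡a) (inverse-fixes σ fb≡b))
    where
      below-image : (τ : Aut L) → Aut.f τ a ≡ a → Aut.f τ b ≡ b → (a ∨ b) ≤ Aut.f τ (a ∨ b)
      below-image τ τa≡a τb≡b =
        ∨-least (subst (_≤ Aut.f τ (a ∨ b)) τa≡a (monotone τ (x≤x∨y a b)))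
                (subst (_≤ Aut.f τ (a ∨ b)) τb≡b (monotone τ (y≤x∨y a b)))

  fixes-all : (σ : Aut L) → (∀ x → JoinIrr L x → Aut.f σ x ≡ x) → ∀ x → Aut.f σ x ≡ x
  fixes-all σ fixesJoinIrr x = induction x (po-wellFounded isPartialOrder x)
    where
      open Aut σ
      induction : ∀ x → Acc _<_ x → f x ≡ x
      induction x (acc below) with shape x
      ... | least x≤all = fixed-if-below-images σ x (x≤all (f x)) (x≤all (g x))
      ... | joinIrr x-ji = fixesJoinIrr x x-ji
      ... | join a b a<x b<x a∨b≡x =
        subst (λ y → f y ≡ y) a∨b≡x (join-fixed σ a b (induction a (below a<x)) (induction b (below b<x)))

proposition3p6 : (L : FinDistLattice) {C : Set} (φ : Fin (FinDistLattice.n L) → C) → PinsAllQ L φ → PinsAll L φ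
proposition3p6 L φ pinsQ σ preservesφ =
  fixes-all σ (pinsQ (restrict σ) (λ x _ → preservesφ x))
  where open Automorphism L
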